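{- For every real $x$, if $x\in\mathbf{R}$ and $|x|\le 1$, then $x\in{^{co}\mathbf{I}}$.
   Context: Constructive setting. $\mathbf{Sd}=\{ -1,0,1\}$. ${^{co}\mathbf{I}}$ is the greatest fixed point of $\Phi(X)=\{x \mid \exists_{d\in\mathbf{Sd}}\exists_{x'}(x'\in X\wedge |x'|\le 1\wedge x=\frac{d+x'}{2})\}$ (so ${^{co}\mathbf{I}}\subseteq\Phi({^{co}\mathbf{I}})$, and any $X\subseteq\Phi({^{co}\mathbf{I}}\cup X)$ satisfies $X\subseteq{^{co}\mathbf{I}}$); computationally $x\in{^{co}\mathbf{I}}$ means $x$ is given by a signed digit stream. For a real $x$, $x\in\mathbf{R}$ means: there exist a total sequence of rationals $as:\mathbb{N}\to\mathbb{Q}$ and a total monotone modulus $M:\mathbb{Z}^+\to\mathbb{N}$ such that for all $p\in\mathbb{Z}^+$ and all $n\ge M(p)$, $|x-as(n)|<2^{ -(p+1)}$. -}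

module Defs where

open import Data.Nat as ℕ using (ℕ; zero; suc)
open import Data.Rational using (ℚ; 0ℚ; 1ℚ; ½; ∣_∣; _+_; _-_; _*_; -_; _≤_; _<_)
open import Data.Product using (Σ; ∃; _×_)

2^-_ : ℕ → ℚ
2^- zero    = 1ℚ
2^- (suc p) = ½ * (2^- p)

-- Constructive (Cauchy) reals, as in Schwichtenberg's TCF:
-- a real is a Cauchy sequence of rationals with a monotone modulus.

record ℝ : Set where
  field
    seq      : ℕ → ℚ
    mod      : ℕ → ℕ
    mod-mono : ∀ p q → p ℕ.≤ q → mod p ℕ.≤ mod q
    cauchy   : ∀ p n m → mod p ℕ.≤ n → mod p ℕ.≤ m → ∣ seq n - seq m ∣ ≤ 2^- p
open ℝ public

Eventually : (ℕ → Set) → Set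
Eventually P = Σ ℕ λ n₀ → ∀ n → n₀ ℕ.≤ n → P n

AbsLeOne : ℝ → Set
AbsLeOne x = ∀ p → Eventually λ n → ∣ seq x n ∣ ≤ 1ℚ + 2^- p

-- |x - a| < r   for rationals a, r   (strict: separated by some 2^{-k})
AbsDiffLt : ℝ → ℚ → ℚ → Set
AbsDiffLt x a r = Σ ℕ λ k → Eventually λ n → ∣ seq x n - a ∣ + 2^- k ≤ r

data Sd : Set where
  d-1 d0 d1 : Sd

sdℚ : Sd → ℚ
sdℚ d-1 = - 1ℚ
sdℚ d0  = 0ℚ
sdℚ d1  = 1ℚ

IsAvg : ℝ → Sd → ℝ → Set
IsAvg x d x' = ∀ p → Eventually λ n →
  ∣ seq x n - ½ * (sdℚ d + seq x' n) ∣ ≤ 2^- p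

-- The predicate x ∈ R from the paper (p ranges over ℤ⁺ = {p ∈ ℕ | 1 ≤ p})

InR : ℝ → Set
InR x = Σ (ℕ → ℚ) λ as → Σ (ℕ → ℕ) λ M →
  (∀ p q → 1 ℕ.≤ p → p ℕ.≤ q → M p ℕ.≤ M q) ×
  (∀ p n → 1 ℕ.≤ p → M p ℕ.≤ n → AbsDiffLt x (as n) (2^- (suc p)))

-- coI as greatest fixed point of Φ (union of all post-fixed points)

Φ : (ℝ → Set) → ℝ → Set
Φ X x = Σ Sd λ d → Σ ℝ λ x' → X x' × AbsLeOne x' × IsAvg x d x'

coI : ℝ → Set₁
coI x = Σ (ℝ → Set) λ X → X x × (∀ y → X y → Φ X y)

-- The set {y ∣ |y| ≤ 1} is itself a post-fixed point of Φ, hence contained in coI.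
-- Given |y| ≤ 1, take a rational q with |y − q| ≤ 1/8 and the digit d = −1, 0, 1
-- according as q ≤ −1/4, |q| < 1/4, q ≥ 1/4; then |y − d/2| ≤ 1/2, so y' = 2y − d
-- again satisfies |y'| ≤ 1 and y = (d + y')/2.
module Submission where

open import Defs
open import Data.Nat as ℕ using (ℕ; zero; suc)
import Data.Nat.Properties as ℕ
open import Data.Integer using (+_)
open import Data.Rational
  using (ℚ; 0ℚ; 1ℚ; ½; _/_; ∣_∣; _+_; _-_; _*_; -_; _≤_; _≤?_)
open import Data.Rational.Properties
  using ( ≤-trans; ≤-reflexive; <⇒≤; ≰⇒>; ≤ᵇ⇒≤; +-identityʳ; +-mono-≤; +-monoˡ-≤; +-monoʳ-≤
        ; *-monoˡ-≤-nonNeg; neg-antimono-≤; 0≤∣p∣; ∣-p∣≡∣p∣; ∣p∣≡p∨∣p∣≡-p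
        ; ∣p+q∣≤∣p∣+∣q∣; ∣p*q∣≡∣p∣*∣q∣; module ≤-Reasoning)
open import Data.Rational.Solver using (module +-*-Solver)
open import Data.Product using (Σ; _,_)
open import Data.Sum using (inj₁; inj₂)
open import Relation.Nullary using (yes; no)
open import Relation.Binary.PropositionalEquality using (_≡_; refl; sym; cong; subst; module ≡-Reasoning)

open +-*-Solver

2ℚ ¼ ⅛ : ℚ
2ℚ = + 2 / 1
¼  = + 1 / 4
⅛  = + 1 / 8

eventually-zip : ∀ {P Q R : ℕ → Set} → (∀ n → P n → Q n → R n) →
                 Eventually P → Eventually Q → Eventually R
eventually-zip f (m , P≥m) (k , Q≥k) =
  m ℕ.⊔ k , λ n m⊔k≤n → f n (P≥m n (ℕ.≤-trans (ℕ.m≤m⊔n m k) m⊔k≤n))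
                            (Q≥k n (ℕ.≤-trans (ℕ.m≤n⊔m m k) m⊔k≤n))

0≤2^-p : ∀ p → 0ℚ ≤ 2^- p
0≤2^-p zero    = ≤ᵇ⇒≤ _
0≤2^-p (suc p) = *-monoˡ-≤-nonNeg ½ (0≤2^-p p)

approximant : ∀ x p → Eventually λ n → ∣ seq x n - seq x (mod x p) ∣ ≤ 2^- p
approximant x p = mod x p , λ n mod≤n → cauchy x p n (mod x p) mod≤n ℕ.≤-refl

p≤p+q : ∀ {p q} → 0ℚ ≤ q → p ≤ p + q
p≤p+q {p} {q} 0≤q = subst (_≤ p + q) (+-identityʳ p) (+-monoʳ-≤ p 0≤q)

neg-involutive : ∀ p → - - p ≡ p
neg-involutive = solve 1 (λ p → :- :- p := p) refl

p≤∣p∣ : ∀ p → p ≤ ∣ p ∣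
p≤∣p∣ p with ∣p∣≡p∨∣p∣≡-p p
... | inj₁ ∣p∣≡p  = ≤-reflexive (sym ∣p∣≡p)
... | inj₂ ∣p∣≡-p = ≤-trans p≤0 (0≤∣p∣ p)
  where p≤0 : p ≤ 0ℚ
        p≤0 = subst (_≤ 0ℚ) (neg-involutive p)
                (neg-antimono-≤ (subst (0ℚ ≤_) ∣p∣≡-p (0≤∣p∣ p)))

∣p∣≤q⇒p≤q : ∀ {p q} → ∣ p ∣ ≤ q → p ≤ q
∣p∣≤q⇒p≤q {p} = ≤-trans (p≤∣p∣ p)

∣p∣≤q⇒-q≤p : ∀ {p q} → ∣ p ∣ ≤ q → - q ≤ p
∣p∣≤q⇒-q≤p {p} ∣p∣≤q = subst (_ ≤_) (neg-involutive p)
  (neg-antimono-≤ (≤-trans (p≤∣p∣ (- p)) (subst (_≤ _) (sym (∣-p∣≡∣p∣ p)) ∣p∣≤q)))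

-q≤p≤q⇒∣p∣≤q : ∀ {p q} → - q ≤ p → p ≤ q → ∣ p ∣ ≤ q
-q≤p≤q⇒∣p∣≤q {p} {q} -q≤p p≤q with ∣p∣≡p∨∣p∣≡-p p
... | inj₁ ∣p∣≡p  = subst (_≤ q) (sym ∣p∣≡p) p≤q
... | inj₂ ∣p∣≡-p = subst (_≤ q) (sym ∣p∣≡-p)
                      (subst (- p ≤_) (neg-involutive q) (neg-antimono-≤ -q≤p))

double-minus : ℝ → ℚ → ℝ
double-minus y c = record
  { seq      = λ n → 2ℚ * seq y n - c
  ; mod      = λ p → mod y (suc p)
  ; mod-mono = λ p q p≤q → mod-mono y (suc p) (suc q) (ℕ.s≤s p≤q)
  ; cauchy   = λ p n m n≥ m≥ → begin
      ∣ (2ℚ * seq y n - c) - (2ℚ * seq y m - c) ∣ ≡⟨ cong ∣_∣ (factor (seq y n) (seq y m) c) ⟩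
      ∣ 2ℚ * (seq y n - seq y m) ∣                 ≡⟨ ∣p*q∣≡∣p∣*∣q∣ 2ℚ (seq y n - seq y m) ⟩
      2ℚ * ∣ seq y n - seq y m ∣                   ≤⟨ *-monoˡ-≤-nonNeg 2ℚ (cauchy y (suc p) n m n≥ m≥) ⟩
      2ℚ * (½ * 2^- p)                             ≡⟨ twice-half (2^- p) ⟩
      2^- p                                        ∎
  }
  where
  open ≤-Reasoning
  factor : ∀ a b c → (2ℚ * a - c) - (2ℚ * b - c) ≡ 2ℚ * (a - b)
  factor = solve 3 (λ a b c → (con 2ℚ :* a :- c) :- (con 2ℚ :* b :- c) := con 2ℚ :* (a :- b)) refl
  twice-half : ∀ e → 2ℚ * (½ * e) ≡ e
  twice-half = solve 1 (λ e → con 2ℚ :* (con ½ :* e) := e) refl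

isAvg-double-minus : ∀ y d → IsAvg y d (double-minus y (sdℚ d))
isAvg-double-minus y d p = 0 , λ n _ →
  subst (λ z → ∣ z ∣ ≤ 2^- p) (sym (cancel (seq y n) (sdℚ d))) (0≤2^-p p)
  where cancel : ∀ a c → a - ½ * (c + (2ℚ * a - c)) ≡ 0ℚ
        cancel = solve 2 (λ a c → a :- con ½ :* (c :+ (con 2ℚ :* a :- c)) := con 0ℚ) refl

∣2a-c∣-bound : ∀ {a c e} → ∣ a - ½ * c ∣ ≤ ½ + ½ * e → ∣ 2ℚ * a - c ∣ ≤ 1ℚ + e
∣2a-c∣-bound {a} {c} {e} close = begin
  ∣ 2ℚ * a - c ∣            ≡⟨ cong ∣_∣ (factor a c) ⟩
  ∣ 2ℚ * (a - ½ * c) ∣      ≡⟨ ∣p*q∣≡∣p∣*∣q∣ 2ℚ (a - ½ * c) ⟩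
  2ℚ * ∣ a - ½ * c ∣        ≤⟨ *-monoˡ-≤-nonNeg 2ℚ close ⟩
  2ℚ * (½ + ½ * e)          ≡⟨ expand e ⟩
  1ℚ + e                    ∎
  where
  open ≤-Reasoning
  factor : ∀ a c → 2ℚ * a - c ≡ 2ℚ * (a - ½ * c)
  factor = solve 2 (λ a c → con 2ℚ :* a :- c := con 2ℚ :* (a :- con ½ :* c)) refl
  expand : ∀ e → 2ℚ * (½ + ½ * e) ≡ 1ℚ + e
  expand = solve 1 (λ e → con 2ℚ :* (con ½ :+ con ½ :* e) := con 1ℚ :+ e) refl

digit0-close : ∀ {a q ε} → 0ℚ ≤ ε → ∣ q ∣ ≤ ¼ → ∣ a - q ∣ ≤ ⅛ → ∣ a - 0ℚ ∣ ≤ ½ + ε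
digit0-close {a} {q} {ε} 0≤ε ∣q∣≤¼ a≈q = begin
  ∣ a - 0ℚ ∣          ≡⟨ cong ∣_∣ (split a q) ⟩
  ∣ (a - q) + q ∣     ≤⟨ ∣p+q∣≤∣p∣+∣q∣ (a - q) q ⟩
  ∣ a - q ∣ + ∣ q ∣   ≤⟨ +-mono-≤ a≈q ∣q∣≤¼ ⟩
  ⅛ + ¼               ≤⟨ ≤ᵇ⇒≤ _ ⟩
  ½                   ≤⟨ p≤p+q 0≤ε ⟩
  ½ + ε               ∎
  where
  open ≤-Reasoning
  split : ∀ a q → a - 0ℚ ≡ (a - q) + q
  split = solve 2 (λ a q → a :- con 0ℚ := (a :- q) :+ q) refl

digit1-close : ∀ {a q ε} → 0ℚ ≤ ε → ¼ ≤ q → ∣ a - q ∣ ≤ ⅛ → ∣ a ∣ ≤ 1ℚ + ε →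
               ∣ a - ½ ∣ ≤ ½ + ε
digit1-close {a} {q} {ε} 0≤ε ¼≤q a≈q ∣a∣≤1+ε = -q≤p≤q⇒∣p∣≤q lower upper
  where
  open ≤-Reasoning
  split : ∀ a q → (a - q) + (q - ½) ≡ a - ½
  split = solve 2 (λ a q → (a :- q) :+ (q :- con ½) := a :- con ½) refl
  shift : ∀ ε → (1ℚ + ε) - ½ ≡ ½ + ε
  shift = solve 1 (λ ε → (con 1ℚ :+ ε) :- con ½ := con ½ :+ ε) refl
  lower : - (½ + ε) ≤ a - ½
  lower = begin
    - (½ + ε)          ≤⟨ neg-antimono-≤ (p≤p+q {½} 0≤ε) ⟩
    - ½                ≤⟨ ≤ᵇ⇒≤ _ ⟩
    - ⅛ + (¼ - ½)      ≤⟨ +-mono-≤ (∣p∣≤q⇒-q≤p a≈q) (+-monoˡ-≤ (- ½) ¼≤q) ⟩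
    (a - q) + (q - ½)  ≡⟨ split a q ⟩
    a - ½              ∎
  upper : a - ½ ≤ ½ + ε
  upper = begin
    a - ½              ≤⟨ +-monoˡ-≤ (- ½) (∣p∣≤q⇒p≤q ∣a∣≤1+ε) ⟩
    (1ℚ + ε) - ½       ≡⟨ shift ε ⟩
    ½ + ε              ∎

-- The digit −1 is the mirror image of the digit 1 under a ↦ −a.
digit-1-close : ∀ {a q ε} → 0ℚ ≤ ε → q ≤ - ¼ → ∣ a - q ∣ ≤ ⅛ → ∣ a ∣ ≤ 1ℚ + ε →
                ∣ a - - ½ ∣ ≤ ½ + ε
digit-1-close {a} {q} {ε} 0≤ε q≤-¼ a≈q ∣a∣≤1+ε =
  subst (_≤ ½ + ε) (mirror a (- ½))
    (digit1-close 0≤ε (neg-antimono-≤ q≤-¼)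
      (subst (_≤ ⅛) (sym (mirror a q)) a≈q)
      (subst (_≤ 1ℚ + ε) (sym (∣-p∣≡∣p∣ a)) ∣a∣≤1+ε))
  where
  mirror : ∀ a b → ∣ - a - - b ∣ ≡ ∣ a - b ∣
  mirror a b = begin
    ∣ - a - - b ∣   ≡⟨ cong ∣_∣ (solve 2 (λ a b → :- a :- :- b := :- (a :- b)) refl a b) ⟩
    ∣ - (a - b) ∣   ≡⟨ ∣-p∣≡∣p∣ (a - b) ⟩
    ∣ a - b ∣       ∎
    where open ≡-Reasoning

digit-choice : ∀ q → Σ Sd λ d → ∀ {a ε} → 0ℚ ≤ ε → ∣ a - q ∣ ≤ ⅛ → ∣ a ∣ ≤ 1ℚ + ε →
               ∣ a - ½ * sdℚ d ∣ ≤ ½ + ε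
digit-choice q with q ≤? - ¼
... | yes q≤-¼ = d-1 , λ 0≤ε a≈q ∣a∣≤1+ε → digit-1-close 0≤ε q≤-¼ a≈q ∣a∣≤1+ε
... | no q≰-¼ with ¼ ≤? q
...   | yes ¼≤q = d1 , λ 0≤ε a≈q ∣a∣≤1+ε → digit1-close 0≤ε ¼≤q a≈q ∣a∣≤1+ε
...   | no ¼≰q  = d0 , λ {a} 0≤ε a≈q _ → digit0-close {a} 0≤ε ∣q∣≤¼ a≈q
  where ∣q∣≤¼ : ∣ q ∣ ≤ ¼
        ∣q∣≤¼ = -q≤p≤q⇒∣p∣≤q (<⇒≤ (≰⇒> q≰-¼)) (<⇒≤ (≰⇒> ¼≰q))

absLeOne-postFixed : ∀ y → AbsLeOne y → Φ AbsLeOne y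
absLeOne-postFixed y ∣y∣≤1 with digit-choice (seq y (mod y 3))
... | d , close = d , y′ , ∣y′∣≤1 , ∣y′∣≤1 , isAvg-double-minus y d
  where
  y′ = double-minus y (sdℚ d)
  ∣y′∣≤1 : AbsLeOne y′
  ∣y′∣≤1 p = eventually-zip
    (λ n a≈q ∣a∣≤1+ε → ∣2a-c∣-bound {seq y n} {sdℚ d} {2^- p} (close (0≤2^-p (suc p)) a≈q ∣a∣≤1+ε))
    (approximant y 3) (∣y∣≤1 (suc p))

-- The hypothesis x ∈ R is not needed: a value of ℝ already carries a Cauchy modulus.
theorem2p9 : (x : ℝ) → InR x → AbsLeOne x → coI x
theorem2p9 x _ ∣x∣≤1 = AbsLeOne , ∣x∣≤1 , absLeOne-postFixed
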